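{- Let $\mathbf L=(L,\vee,\wedge,{}^*,0,1)$ be a pseudocomplemented lattice and $\Theta$ a congruence of $\mathbf L$. Then the class $[1]\Theta=\{x\in L\mid (x,1)\in\Theta\}$ is a deductive system of the first kind of $\mathbf L$ and is a sublattice of $(L,\vee,\wedge)$.
   Context: A bounded lattice is pseudocomplemented if for each $a$ there is a greatest element $a^*$ with $a\wedge a^*=0$. A congruence of $\mathbf L$ is an equivalence relation on $L$ compatible with $\vee$, $\wedge$ and ${}^*$. Define $x\rightarrow y:=x^*\vee y$. A deductive system of the first kind of $\mathbf L$ is a subset $A\subseteq L$ such that $1\in A$, and whenever $x\in A$, $y\in L$ and $x\rightarrow y\in A$, then $y\in A$. -}

module Defs where

open import Level using (Level; _⊔_; suc)
open import Algebra.Core using (Op₁; Op₂)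
open import Algebra.Lattice.Bundles using (Lattice)
open import Relation.Binary.Core using (Rel)
open import Relation.Binary.Structures using (IsEquivalence)
open import Relation.Unary using (Pred; _∈_)

record PseudocomplementedLattice c ℓ : Set (suc (c ⊔ ℓ)) where
  field
    lattice : Lattice c ℓ
  open Lattice lattice public
  _≤_ : Rel Carrier ℓ
  x ≤ y = (x ∧ y) ≈ x
  field
    ⊥ : Carrier
    ⊤ : Carrier
    ⊥-min : ∀ x → ⊥ ≤ x
    ⊤-max : ∀ x → x ≤ ⊤
    _* : Op₁ Carrier
    *-cong : ∀ {x y} → x ≈ y → (x *) ≈ (y *)
    *-disjoint : ∀ a → (a ∧ (a *)) ≈ ⊥
    *-greatest : ∀ a x → (a ∧ x) ≈ ⊥ → x ≤ (a *)

  _⇒_ : Op₂ Carrier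
  x ⇒ y = (x *) ∨ y

module _ {c ℓ : Level} (𝐋 : PseudocomplementedLattice c ℓ) where
  open PseudocomplementedLattice 𝐋

  record IsCongruence {r : Level} (Θ : Rel Carrier r) : Set (c ⊔ ℓ ⊔ r) where
    field
      isEquivalence : IsEquivalence Θ
      ≈⇒Θ : ∀ {x y} → x ≈ y → Θ x y
      ∨-compat : ∀ {x y u v} → Θ x y → Θ u v → Θ (x ∨ u) (y ∨ v)
      ∧-compat : ∀ {x y u v} → Θ x y → Θ u v → Θ (x ∧ u) (y ∧ v)
      *-compat : ∀ {x y} → Θ x y → Θ (x *) (y *)

  classOf1 : ∀ {r} → Rel Carrier r → Pred Carrier r
  classOf1 Θ x = Θ x ⊤

  record IsDeductiveSystem₁ {r : Level} (A : Pred Carrier r) : Set (c ⊔ r) where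
    field
      ⊤∈ : ⊤ ∈ A
      mp : ∀ {x y} → x ∈ A → (x ⇒ y) ∈ A → y ∈ A

  record IsSublattice {r : Level} (A : Pred Carrier r) : Set (c ⊔ r) where
    field
      ∨-closed : ∀ {x y} → x ∈ A → y ∈ A → (x ∨ y) ∈ A
      ∧-closed : ∀ {x y} → x ∈ A → y ∈ A → (x ∧ y) ∈ A

-- Every congruence class is closed under ∨ and ∧ by idempotence; for the
-- class of 1 modus ponens holds because x Θ 1 gives x* Θ 1* = 0, so
-- x* ∨ y Θ 0 ∨ y = y.
module Submission where

open import Defs
open import Level using (Level)
open import Data.Product using (_×_; _,_; proj₁)
open import Relation.Binary.Core using (Rel)
open import Relation.Binary.Structures using (IsEquivalence)
import Algebra.Lattice.Properties.Lattice as LatticeProperties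
import Relation.Binary.Reasoning.Setoid as SetoidReasoning

module PseudocomplementProperties {c ℓ} (𝐋 : PseudocomplementedLattice c ℓ) where
  open PseudocomplementedLattice 𝐋
  open SetoidReasoning setoid

  ⊤*≈⊥ : (⊤ *) ≈ ⊥
  ⊤*≈⊥ = begin
    ⊤ *        ≈⟨ ⊤-max (⊤ *) ⟨
    ⊤ * ∧ ⊤    ≈⟨ ∧-comm (⊤ *) ⊤ ⟩
    ⊤ ∧ ⊤ *    ≈⟨ *-disjoint ⊤ ⟩
    ⊥          ∎

  ∨-identityˡ : ∀ y → (⊥ ∨ y) ≈ y
  ∨-identityˡ y = begin
    ⊥ ∨ y        ≈⟨ ∨-comm ⊥ y ⟩
    y ∨ ⊥        ≈⟨ ∨-cong refl (⊥-min y) ⟨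
    y ∨ (⊥ ∧ y)  ≈⟨ ∨-cong refl (∧-comm ⊥ y) ⟩
    y ∨ (y ∧ ⊥)  ≈⟨ proj₁ absorptive y ⊥ ⟩
    y            ∎

module CongruenceProperties
  {c ℓ r} (𝐋 : PseudocomplementedLattice c ℓ)
  {Θ : Rel (PseudocomplementedLattice.Carrier 𝐋) r} (isCongruence : IsCongruence 𝐋 Θ)
  where
  open PseudocomplementedLattice 𝐋
  open PseudocomplementProperties 𝐋
  open LatticeProperties lattice using (∧-idem; ∨-idem)
  open IsCongruence isCongruence
  open IsEquivalence (IsCongruence.isEquivalence isCongruence)
    renaming (refl to Θ-refl; sym to Θ-sym; trans to Θ-trans)

  class-∨-closed : ∀ {a x y} → Θ x a → Θ y a → Θ (x ∨ y) a
  class-∨-closed x∼a y∼a = Θ-trans (∨-compat x∼a y∼a) (≈⇒Θ (∨-idem _))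

  class-∧-closed : ∀ {a x y} → Θ x a → Θ y a → Θ (x ∧ y) a
  class-∧-closed x∼a y∼a = Θ-trans (∧-compat x∼a y∼a) (≈⇒Θ (∧-idem _))

  classOf1-mp : ∀ {x y} → Θ x ⊤ → Θ (x ⇒ y) ⊤ → Θ y ⊤
  classOf1-mp {x} {y} x∼⊤ x⇒y∼⊤ =
    Θ-trans (Θ-sym (≈⇒Θ (∨-identityˡ y)))
      (Θ-trans (Θ-sym (∨-compat x*∼⊥ Θ-refl)) x⇒y∼⊤)
    where
    x*∼⊥ : Θ (x *) ⊥
    x*∼⊥ = Θ-trans (*-compat x∼⊤) (≈⇒Θ ⊤*≈⊥)

lemma5p4 : ∀ {c ℓ r : Level} (𝐋 : PseudocomplementedLattice c ℓ)
    (Θ : Rel (PseudocomplementedLattice.Carrier 𝐋) r) → IsCongruence 𝐋 Θ →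
    IsDeductiveSystem₁ 𝐋 (classOf1 𝐋 Θ) × IsSublattice 𝐋 (classOf1 𝐋 Θ)
lemma5p4 𝐋 Θ isCongruence =
    record { ⊤∈ = Θ-refl ; mp = classOf1-mp }
  , record { ∨-closed = class-∨-closed ; ∧-closed = class-∧-closed }
  where
  open CongruenceProperties 𝐋 isCongruence
  open IsEquivalence (IsCongruence.isEquivalence isCongruence) renaming (refl to Θ-refl)
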